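{- Let $n\ge3$ and let $L_n$ be the $n\times n$ matrix indexed by $0,\ldots,n-1$ with $(0,0)$ entry $3$, $(i,i)$ entry $2$ for $1\le i\le n-1$, entry $-1$ in positions $(i,j)$ with $j\equiv i\pm1\pmod n$, and $0$ elsewhere. Let $\Pi_n=\{\sum_j t_ju_j: 0\le t_j<1\}$ be the half-open fundamental parallelepiped spanned by the columns $u_0,\ldots,u_{n-1}$ of $nL_n^{ -1}$. Suppose $x=(x_0,x_1,\ldots,x_{n-1})\in\Pi_n$ is of the form $x=L_n^{ -1}c$ for a vector $c$ with entries in $\{0,1,\ldots,n-1\}$. Then $x$ is an integer point if and only if $x_1$ is an integer. -}

module Defs where

open import Data.Nat as ℕ using (ℕ; zero; suc)
open import Data.Fin using (Fin; zero; suc; toℕ)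
open import Data.Integer as ℤ using (ℤ; +_)
open import Data.Rational using (ℚ; 0ℚ; 1ℚ; _+_; _*_; -_; _/_)
open import Data.Product using (∃)
open import Relation.Binary.PropositionalEquality using (_≡_)
open import Relation.Nullary.Decidable using (Dec; yes; no; _⊎-dec_; _×-dec_)

Mat : ℕ → Set
Mat n = Fin n → Fin n → ℚ

Vecℚ : ℕ → Set
Vecℚ n = Fin n → ℚ

ℕtoℚ : ℕ → ℚ
ℕtoℚ k = (+ k) / 1

sumFin : ∀ {n} → (Fin n → ℚ) → ℚ
sumFin {zero}  f = 0ℚ
sumFin {suc n} f = f zero + sumFin {n} (λ j → f (suc j))

_⊗_ : ∀ {n} → Mat n → Mat n → Mat n
(A ⊗ B) i k = sumFin (λ j → A i j * B j k)

_·v_ : ∀ {n} → Mat n → Vecℚ n → Vecℚ n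
(A ·v v) i = sumFin (λ j → A i j * v j)

identity : ∀ {n} → Mat n
identity i j with toℕ i ℕ.≟ toℕ j
... | yes _ = 1ℚ
... | no  _ = 0ℚ

-- j ≡ i ± 1 (mod n), for indices i j < n
adjModℕ : ℕ → ℕ → ℕ → Set
adjModℕ n a b = (b ≡ suc a) Data.Sum.⊎ ((a ≡ suc b) Data.Sum.⊎ (((a ≡ 0) Data.Product.× (suc b ≡ n)) Data.Sum.⊎ ((b ≡ 0) Data.Product.× (suc a ≡ n))))
  where import Data.Sum; import Data.Product

adjMod? : ∀ n a b → Dec (adjModℕ n a b)
adjMod? n a b = (b ℕ.≟ suc a) ⊎-dec ((a ℕ.≟ suc b) ⊎-dec (((a ℕ.≟ 0) ×-dec (suc b ℕ.≟ n)) ⊎-dec ((b ℕ.≟ 0) ×-dec (suc a ℕ.≟ n))))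

Lmat : (n : ℕ) → Mat n
Lmat n i j with toℕ i ℕ.≟ toℕ j
... | yes _ with toℕ i
...   | zero  = ℕtoℚ 3
...   | suc _ = ℕtoℚ 2
Lmat n i j | no _ with adjMod? n (toℕ i) (toℕ j)
...   | yes _ = - 1ℚ
...   | no  _ = 0ℚ

InParallelepiped : ∀ {n} → Mat n → Vecℚ n → Set
InParallelepiped {n} U x =
  ∃ λ (t : Vecℚ n) →
    (∀ j → 0ℚ Data.Rational.≤ t j Data.Product.× t j Data.Rational.< 1ℚ)
    Data.Product.× (∀ i → x i ≡ sumFin (λ j → t j * U i j))
  where import Data.Product; import Data.Rational

scaleMat : ∀ {n} → ℚ → Mat n → Mat n
scaleMat k M i j = k * M i j

IsInt : ℚ → Set
IsInt q = ∃ λ (z : ℤ) → q ≡ z / 1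

-- Since L M = I, the hypothesis x = M c says L x = c.  L is symmetric, its first row sums
-- to 1 and every other row to 0, so summing the equations L x = c gives x₀ = Σᵢ cᵢ ∈ ℤ.
-- Row k+1 of L x = c reads x_{k+2} = 2 x_{k+1} − x_k − c_{k+1}, so once x₁ is an integer
-- integrality propagates along the whole vector.
module Submission where

open import Defs
open import Data.Nat using (ℕ; zero; suc; _<_; _≟_)
import Data.Nat.Properties as ℕ
open import Data.Fin as Fin using (Fin; zero; suc; toℕ; inject₁; fromℕ; punchIn; punchOut)
open import Data.Fin.Properties
  using (toℕ-injective; toℕ-inject₁; toℕ-fromℕ; toℕ<n; punchIn-punchOut; punchInᵢ≢i; punchIn-injective; punchOut-injective)
open import Data.Fin.Relation.Unary.Top using (view; ‵fromℕ; ‵inject₁)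
open import Data.Integer as ℤ using (-[1+_])
import Data.Integer.Properties as ℤ
open import Data.Nat.Coprimality as Coprime using (1-coprimeTo)
open import Data.Rational using (ℚ; mkℚ; 0ℚ; 1ℚ; _+_; _*_; -_; _/_)
open import Data.Rational.Properties
  using (+-*-commutativeRing; +-identityʳ; *-zeroˡ; *-identityˡ; *-identityʳ; *-assoc; ↥p/↧p≡p)
open import Data.Rational.Solver using (module +-*-Solver)
open +-*-Solver using (solve; _:=_; _:+_; _:*_; con)
open import Algebra.Bundles using (CommutativeRing)
open import Algebra.Properties.Semiring.Sum (CommutativeRing.semiring +-*-commutativeRing)
  using (sum; sum-cong-≗; sum-replicate-zero; sum-remove; ∑-comm; *-distribˡ-sum; *-distribʳ-sum)
open import Data.Product using (_,_)
open import Data.Sum using (inj₁; inj₂)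
open import Data.Empty using (⊥-elim)
open import Function.Base using (_∘_)
open import Function.Bundles using (_⇔_; mk⇔)
open import Relation.Nullary using (¬_; yes; no)
open import Relation.Binary.PropositionalEquality

z/1≡mkℚ : ∀ z → z / 1 ≡ mkℚ z 0 (Coprime.sym (1-coprimeTo ℤ.∣ z ∣))
z/1≡mkℚ z = ↥p/↧p≡p (mkℚ z 0 _)

isInt-+ : ∀ {p q} → IsInt p → IsInt q → IsInt (p + q)
isInt-+ (z , refl) (w , refl) rewrite z/1≡mkℚ z | z/1≡mkℚ w =
  z ℤ.+ w , cong₂ (λ a b → (a ℤ.+ b) / 1) (ℤ.*-identityʳ z) (ℤ.*-identityʳ w)

isInt-* : ∀ {p q} → IsInt p → IsInt q → IsInt (p * q)
isInt-* (z , refl) (w , refl) rewrite z/1≡mkℚ z | z/1≡mkℚ w = z ℤ.* w , refl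

isInt-ℕ : ∀ k → IsInt (ℕtoℚ k)
isInt-ℕ k = ℤ.+ k , refl

isInt-−1 : IsInt (- 1ℚ)
isInt-−1 = -[1+ 0 ] , refl

isInt-sumFin : ∀ {n} (f : Fin n → ℚ) → (∀ j → IsInt (f j)) → IsInt (sumFin f)
isInt-sumFin {zero}  f int-f = ℤ.+ 0 , refl
isInt-sumFin {suc n} f int-f = isInt-+ (int-f zero) (isInt-sumFin (f ∘ suc) (int-f ∘ suc))

isInt-secondDifference : ∀ {p q r w} → - 1ℚ * p + (ℕtoℚ 2 * q + - 1ℚ * r) ≡ w →
                         IsInt w → IsInt p → IsInt q → IsInt r
isInt-secondDifference {p} {q} {r} {w} eq int-w int-p int-q = subst IsInt (sym r≡)
  (isInt-+ (isInt-* (isInt-ℕ 2) int-q) (isInt-+ (isInt-* isInt-−1 int-p) (isInt-* isInt-−1 int-w)))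
  where
  r≡ : r ≡ ℕtoℚ 2 * q + (- 1ℚ * p + - 1ℚ * w)
  r≡ = trans (solve 3 (λ p q r → r := con (ℕtoℚ 2) :* q :+ (con (- 1ℚ) :* p :+
                        con (- 1ℚ) :* (con (- 1ℚ) :* p :+ (con (ℕtoℚ 2) :* q :+ con (- 1ℚ) :* r))))
                      refl p q r)
             (cong (λ t → ℕtoℚ 2 * q + (- 1ℚ * p + - 1ℚ * t)) eq)

sumFin≡sum : ∀ {n} (f : Fin n → ℚ) → sumFin f ≡ sum f
sumFin≡sum {zero}  f = refl
sumFin≡sum {suc n} f = cong (f zero +_) (sumFin≡sum (f ∘ suc))

sum-zero : ∀ {n} (f : Fin n → ℚ) → (∀ j → f j ≡ 0ℚ) → sum f ≡ 0ℚ
sum-zero {n} f f≗0 = trans (sum-cong-≗ f≗0) (sum-replicate-zero n)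

sum-support₁ : ∀ {n} (f : Fin n → ℚ) p → (∀ j → j ≢ p → f j ≡ 0ℚ) → sum f ≡ f p
sum-support₁ {suc n} f p off = begin
  sum f                      ≡⟨ sum-remove {i = p} f ⟩
  f p + sum (f ∘ punchIn p)  ≡⟨ cong (f p +_) (sum-zero _ (λ j → off _ (punchInᵢ≢i p j))) ⟩
  f p + 0ℚ                   ≡⟨ +-identityʳ (f p) ⟩
  f p                        ∎
  where open ≡-Reasoning

punchIn-≢ : ∀ {n} {p q : Fin (suc n)} (p≢q : p ≢ q) {j} → j ≢ punchOut p≢q → punchIn p j ≢ q
punchIn-≢ {p = p} p≢q {j} j≢q′ e = j≢q′ (punchIn-injective p j _ (trans e (sym (punchIn-punchOut p≢q))))

sum-support₂ : ∀ {n} (f : Fin n → ℚ) {p q} → p ≢ q →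
               (∀ j → j ≢ p → j ≢ q → f j ≡ 0ℚ) → sum f ≡ f p + f q
sum-support₂ {suc n} f {p} {q} p≢q off = begin
  sum f                      ≡⟨ sum-remove {i = p} f ⟩
  f p + sum (f ∘ punchIn p)  ≡⟨ cong (f p +_) (sum-support₁ (f ∘ punchIn p) q′ off′) ⟩
  f p + f (punchIn p q′)     ≡⟨ cong (λ k → f p + f k) (punchIn-punchOut p≢q) ⟩
  f p + f q                  ∎
  where
  open ≡-Reasoning
  q′ = punchOut p≢q
  off′ : ∀ j → j ≢ q′ → f (punchIn p j) ≡ 0ℚ
  off′ j j≢q′ = off _ (punchInᵢ≢i p j) (punchIn-≢ p≢q j≢q′)

sum-support₃ : ∀ {n} (f : Fin n → ℚ) {p q r} → p ≢ q → p ≢ r → q ≢ r →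
               (∀ j → j ≢ p → j ≢ q → j ≢ r → f j ≡ 0ℚ) → sum f ≡ f p + (f q + f r)
sum-support₃ {suc n} f {p} {q} {r} p≢q p≢r q≢r off = begin
  sum f                                        ≡⟨ sum-remove {i = p} f ⟩
  f p + sum (f ∘ punchIn p)                    ≡⟨ cong (f p +_) (sum-support₂ (f ∘ punchIn p) q′≢r′ off′) ⟩
  f p + (f (punchIn p q′) + f (punchIn p r′))  ≡⟨ cong₂ (λ k l → f p + (f k + f l))
                                                        (punchIn-punchOut p≢q) (punchIn-punchOut p≢r) ⟩
  f p + (f q + f r)                            ∎
  where
  open ≡-Reasoning
  q′ = punchOut p≢q
  r′ = punchOut p≢r
  q′≢r′ : q′ ≢ r′
  q′≢r′ = q≢r ∘ punchOut-injective p≢q p≢r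
  off′ : ∀ j → j ≢ q′ → j ≢ r′ → f (punchIn p j) ≡ 0ℚ
  off′ j j≢q′ j≢r′ = off _ (punchInᵢ≢i p j) (punchIn-≢ p≢q j≢q′) (punchIn-≢ p≢r j≢r′)

·v-sum : ∀ {n} (A : Mat n) (x : Vecℚ n) i → (A ·v x) i ≡ sum (λ j → A i j * x j)
·v-sum A x i = sumFin≡sum (λ j → A i j * x j)

⊗-sum : ∀ {n} (A B : Mat n) i k → (A ⊗ B) i k ≡ sum (λ j → A i j * B j k)
⊗-sum A B i k = sumFin≡sum (λ j → A i j * B j k)

identity-diag : ∀ {n} (i : Fin n) → identity i i ≡ 1ℚ
identity-diag i with toℕ i ≟ toℕ i
... | yes _ = refl
... | no ¬e = ⊥-elim (¬e refl)

identity-offdiag : ∀ {n} {i j : Fin n} → j ≢ i → identity i j ≡ 0ℚ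
identity-offdiag {i = i} {j} j≢i with toℕ i ≟ toℕ j
... | yes e = ⊥-elim (j≢i (sym (toℕ-injective e)))
... | no _  = refl

identity-·v : ∀ {n} (v : Vecℚ n) i → (identity ·v v) i ≡ v i
identity-·v v i = begin
  (identity ·v v) i               ≡⟨ ·v-sum identity v i ⟩
  sum (λ j → identity i j * v j)  ≡⟨ sum-support₁ _ i (λ j j≢i → trans (cong (_* v j) (identity-offdiag j≢i)) (*-zeroˡ (v j))) ⟩
  identity i i * v i              ≡⟨ cong (_* v i) (identity-diag i) ⟩
  1ℚ * v i                        ≡⟨ *-identityˡ (v i) ⟩
  v i                             ∎
  where open ≡-Reasoning

⊗-·v-assoc : ∀ {n} (A B : Mat n) (v : Vecℚ n) i → ((A ⊗ B) ·v v) i ≡ (A ·v (B ·v v)) i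
⊗-·v-assoc A B v i = begin
  ((A ⊗ B) ·v v) i                               ≡⟨ ·v-sum (A ⊗ B) v i ⟩
  sum (λ j → (A ⊗ B) i j * v j)                  ≡⟨ sum-cong-≗ (λ j → cong (_* v j) (⊗-sum A B i j)) ⟩
  sum (λ j → sum (λ k → A i k * B k j) * v j)    ≡⟨ sum-cong-≗ (λ j → *-distribʳ-sum (v j) (λ k → A i k * B k j)) ⟩
  sum (λ j → sum (λ k → A i k * B k j * v j))    ≡⟨ ∑-comm (λ j k → A i k * B k j * v j) ⟩
  sum (λ k → sum (λ j → A i k * B k j * v j))    ≡⟨ sum-cong-≗ (λ k → sum-cong-≗ (λ j → *-assoc (A i k) (B k j) (v j))) ⟩
  sum (λ k → sum (λ j → A i k * (B k j * v j)))  ≡⟨ sum-cong-≗ (λ k → *-distribˡ-sum (A i k) (λ j → B k j * v j)) ⟨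
  sum (λ k → A i k * sum (λ j → B k j * v j))    ≡⟨ sum-cong-≗ (λ k → cong (A i k *_) (·v-sum B v k)) ⟨
  sum (λ k → A i k * (B ·v v) k)                 ≡⟨ ·v-sum A (B ·v v) i ⟨
  (A ·v (B ·v v)) i                              ∎
  where open ≡-Reasoning

·v-leftInverse : ∀ {n} (A M : Mat n) {x v : Vecℚ n} → (∀ i j → (A ⊗ M) i j ≡ identity i j) →
                 (∀ i → x i ≡ (M ·v v) i) → ∀ i → (A ·v x) i ≡ v i
·v-leftInverse A M {x} {v} AM≡I x≡Mv i = begin
  (A ·v x) i                      ≡⟨ ·v-sum A x i ⟩
  sum (λ j → A i j * x j)         ≡⟨ sum-cong-≗ (λ j → cong (A i j *_) (x≡Mv j)) ⟩
  sum (λ j → A i j * (M ·v v) j)  ≡⟨ ·v-sum A (M ·v v) i ⟨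
  (A ·v (M ·v v)) i               ≡⟨ ⊗-·v-assoc A M v i ⟨
  ((A ⊗ M) ·v v) i                ≡⟨ ·v-sum (A ⊗ M) v i ⟩
  sum (λ j → (A ⊗ M) i j * v j)   ≡⟨ sum-cong-≗ (λ j → cong (_* v j) (AM≡I i j)) ⟩
  sum (λ j → identity i j * v j)  ≡⟨ ·v-sum identity v i ⟨
  (identity ·v v) i               ≡⟨ identity-·v v i ⟩
  v i                             ∎
  where open ≡-Reasoning

·v-three-entries : ∀ {n} (A : Mat n) (x : Vecℚ n) {i p q r} → p ≢ q → p ≢ r → q ≢ r →
                   (∀ j → j ≢ p → j ≢ q → j ≢ r → A i j ≡ 0ℚ) →
                   (A ·v x) i ≡ A i p * x p + (A i q * x q + A i r * x r)
·v-three-entries A x {i} p≢q p≢r q≢r off = trans (·v-sum A x i)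
  (sum-support₃ (λ j → A i j * x j) p≢q p≢r q≢r
    (λ j j≢p j≢q j≢r → trans (cong (_* x j) (off j j≢p j≢q j≢r)) (*-zeroˡ (x j))))

colSum : ∀ {n} → Mat n → Fin n → ℚ
colSum A j = sum (λ i → A i j)

colSum-symmetric : ∀ {n} (A : Mat n) → (∀ i j → A i j ≡ A j i) → ∀ j → colSum A j ≡ (A ·v (λ _ → 1ℚ)) j
colSum-symmetric A A-sym j = begin
  sum (λ i → A i j)       ≡⟨ sum-cong-≗ (λ i → trans (A-sym i j) (sym (*-identityʳ (A j i)))) ⟩
  sum (λ i → A j i * 1ℚ)  ≡⟨ ·v-sum A (λ _ → 1ℚ) j ⟨
  (A ·v (λ _ → 1ℚ)) j     ∎
  where open ≡-Reasoning

sum-·v : ∀ {n} (A : Mat n) (x : Vecℚ n) → sum (A ·v x) ≡ sum (λ j → colSum A j * x j)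
sum-·v A x = begin
  sum (A ·v x)                         ≡⟨ sum-cong-≗ (·v-sum A x) ⟩
  sum (λ i → sum (λ j → A i j * x j))  ≡⟨ ∑-comm (λ i j → A i j * x j) ⟩
  sum (λ j → sum (λ i → A i j * x j))  ≡⟨ sum-cong-≗ (λ j → *-distribʳ-sum (x j) (λ i → A i j)) ⟨
  sum (λ j → colSum A j * x j)         ∎
  where open ≡-Reasoning

sum-·v-unitColSums : ∀ {n} (A : Mat n) (x : Vecℚ n) {i} →
                     (∀ j → colSum A j ≡ identity i j) → sum (A ·v x) ≡ x i
sum-·v-unitColSums A x {i} colSum≡δ = begin
  sum (A ·v x)                    ≡⟨ sum-·v A x ⟩
  sum (λ j → colSum A j * x j)    ≡⟨ sum-cong-≗ (λ j → cong (_* x j) (colSum≡δ j)) ⟩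
  sum (λ j → identity i j * x j)  ≡⟨ ·v-sum identity x i ⟨
  (identity ·v x) i               ≡⟨ identity-·v x i ⟩
  x i                             ∎
  where open ≡-Reasoning

Fin-twoStepInduction : ∀ {n} (P : Fin (suc (suc n)) → Set) → P zero → P (suc zero) →
                       (∀ k → P (inject₁ (inject₁ k)) → P (suc (inject₁ k)) → P (suc (suc k))) →
                       ∀ j → P j
Fin-twoStepInduction {zero}  P P₀ P₁ step zero       = P₀
Fin-twoStepInduction {zero}  P P₀ P₁ step (suc zero) = P₁
Fin-twoStepInduction {suc n} P P₀ P₁ step zero       = P₀
Fin-twoStepInduction {suc n} P P₀ P₁ step (suc j)    =
  Fin-twoStepInduction (P ∘ suc) P₁ (step zero P₀ P₁) (step ∘ suc) j

toℕ-<⇒≢ : ∀ {n} {i j : Fin n} → toℕ i < toℕ j → i ≢ j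
toℕ-<⇒≢ lt i≡j = ℕ.<⇒≢ lt (cong toℕ i≡j)

adjModℕ-sym : ∀ {n a b} → adjModℕ n a b → adjModℕ n b a
adjModℕ-sym (inj₁ e)               = inj₂ (inj₁ e)
adjModℕ-sym (inj₂ (inj₁ e))        = inj₁ e
adjModℕ-sym (inj₂ (inj₂ (inj₁ e))) = inj₂ (inj₂ (inj₂ e))
adjModℕ-sym (inj₂ (inj₂ (inj₂ e))) = inj₂ (inj₂ (inj₁ e))

Lmat-diag : ∀ {n} {i j : Fin n} {t} → toℕ i ≡ suc t → toℕ j ≡ suc t → Lmat n i j ≡ ℕtoℚ 2
Lmat-diag {i = i} {j} i≡1+t j≡1+t with toℕ i ≟ toℕ j
... | no i≢j = ⊥-elim (i≢j (trans i≡1+t (sym j≡1+t)))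
... | yes _ with toℕ i
...   | suc _ = refl
Lmat-diag () _ | yes _ | zero

Lmat-adjacent : ∀ {n} {i j : Fin n} → i ≢ j → adjModℕ n (toℕ i) (toℕ j) → Lmat n i j ≡ - 1ℚ
Lmat-adjacent {n} {i} {j} i≢j adj with toℕ i ≟ toℕ j
... | yes e = ⊥-elim (i≢j (toℕ-injective e))
... | no _ with adjMod? n (toℕ i) (toℕ j)
...   | yes _   = refl
...   | no ¬adj = ⊥-elim (¬adj adj)

Lmat-far : ∀ {n} {i j : Fin n} → i ≢ j → ¬ adjModℕ n (toℕ i) (toℕ j) → Lmat n i j ≡ 0ℚ
Lmat-far {n} {i} {j} i≢j ¬adj with toℕ i ≟ toℕ j
... | yes e = ⊥-elim (i≢j (toℕ-injective e))
... | no _ with adjMod? n (toℕ i) (toℕ j)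
...   | yes adj = ⊥-elim (¬adj adj)
...   | no _    = refl

Lmat-sym : ∀ {n} (i j : Fin n) → Lmat n i j ≡ Lmat n j i
Lmat-sym {n} i j with i Fin.≟ j
... | yes refl = refl
... | no i≢j with adjMod? n (toℕ i) (toℕ j)
...   | yes adj = trans (Lmat-adjacent i≢j adj) (sym (Lmat-adjacent (i≢j ∘ sym) (adjModℕ-sym adj)))
...   | no ¬adj = trans (Lmat-far i≢j ¬adj) (sym (Lmat-far (i≢j ∘ sym) (¬adj ∘ adjModℕ-sym)))

Lmat-row-consecutive : ∀ {n} (x : Vecℚ n) {a b c : Fin n} → toℕ b ≡ suc (toℕ a) → toℕ c ≡ suc (toℕ b) →
                       (Lmat n ·v x) b ≡ - 1ℚ * x a + (ℕtoℚ 2 * x b + - 1ℚ * x c)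
Lmat-row-consecutive {n} x {a} {b} {c} b≡1+a c≡1+b = begin
  (Lmat n ·v x) b                                           ≡⟨ ·v-three-entries (Lmat n) x {i = b} a≢b (toℕ-<⇒≢ a<c) b≢c off ⟩
  Lmat n b a * x a + (Lmat n b b * x b + Lmat n b c * x c)  ≡⟨ cong₂ _+_ (cong (_* x a) Lba)
                                                                   (cong₂ _+_ (cong (_* x b) Lbb) (cong (_* x c) Lbc)) ⟩
  - 1ℚ * x a + (ℕtoℚ 2 * x b + - 1ℚ * x c)                  ∎
  where
  open ≡-Reasoning
  a<b : toℕ a < toℕ b
  a<b = ℕ.≤-reflexive (sym b≡1+a)
  b<c : toℕ b < toℕ c
  b<c = ℕ.≤-reflexive (sym c≡1+b)
  a<c : toℕ a < toℕ c
  a<c = ℕ.<-trans a<b b<c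
  a≢b : a ≢ b
  a≢b = toℕ-<⇒≢ a<b
  b≢c : b ≢ c
  b≢c = toℕ-<⇒≢ b<c
  Lba : Lmat n b a ≡ - 1ℚ
  Lba = Lmat-adjacent (a≢b ∘ sym) (inj₂ (inj₁ b≡1+a))
  Lbb : Lmat n b b ≡ ℕtoℚ 2
  Lbb = Lmat-diag b≡1+a b≡1+a
  Lbc : Lmat n b c ≡ - 1ℚ
  Lbc = Lmat-adjacent b≢c (inj₁ c≡1+b)
  off : ∀ j → j ≢ a → j ≢ b → j ≢ c → Lmat n b j ≡ 0ℚ
  off j j≢a j≢b j≢c = Lmat-far (j≢b ∘ sym) ¬adj
    where
    ¬adj : ¬ adjModℕ n (toℕ b) (toℕ j)
    ¬adj (inj₁ j≡1+b)                     = j≢c (toℕ-injective (trans j≡1+b (sym c≡1+b)))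
    ¬adj (inj₂ (inj₁ b≡1+j))              = j≢a (toℕ-injective (ℕ.suc-injective (trans (sym b≡1+j) b≡1+a)))
    ¬adj (inj₂ (inj₂ (inj₁ (b≡0 , _))))   = ℕ.0≢1+n (trans (sym b≡0) b≡1+a)
    ¬adj (inj₂ (inj₂ (inj₂ (_ , 1+b≡n)))) = ℕ.<⇒≢ (toℕ<n c) (trans c≡1+b 1+b≡n)

Lmat-row-inject₁ : ∀ {n} (x : Vecℚ (suc (suc n))) (k : Fin n) →
                   (Lmat (suc (suc n)) ·v x) (suc (inject₁ k))
                   ≡ - 1ℚ * x (inject₁ (inject₁ k)) + (ℕtoℚ 2 * x (suc (inject₁ k)) + - 1ℚ * x (suc (suc k)))
Lmat-row-inject₁ x k = Lmat-row-consecutive x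
  (cong suc (sym (toℕ-inject₁ (inject₁ k)))) (cong (λ t → suc (suc t)) (sym (toℕ-inject₁ k)))

module _ (m : ℕ) where

  private
    n : ℕ
    n = suc (suc (suc m))
    last : Fin n
    last = fromℕ (suc (suc m))
    toℕ-last : toℕ last ≡ suc (suc m)
    toℕ-last = toℕ-fromℕ (suc (suc m))

  Lmat-row-zero : ∀ (x : Vecℚ n) → (Lmat n ·v x) zero ≡ ℕtoℚ 3 * x zero + (- 1ℚ * x (suc zero) + - 1ℚ * x last)
  Lmat-row-zero x = begin
    (Lmat n ·v x) zero
      ≡⟨ ·v-three-entries (Lmat n) x {i = zero} (λ ()) (λ ()) (λ ()) off ⟩
    Lmat n zero zero * x zero + (Lmat n zero (suc zero) * x (suc zero) + Lmat n zero last * x last)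
      ≡⟨ cong (λ e → ℕtoℚ 3 * x zero + (- 1ℚ * x (suc zero) + e * x last)) L0l ⟩
    ℕtoℚ 3 * x zero + (- 1ℚ * x (suc zero) + - 1ℚ * x last)
      ∎
    where
    open ≡-Reasoning
    L0l : Lmat n zero last ≡ - 1ℚ
    L0l = Lmat-adjacent (λ ()) (inj₂ (inj₂ (inj₁ (refl , cong suc toℕ-last))))
    off : ∀ j → j ≢ zero → j ≢ suc zero → j ≢ last → Lmat n zero j ≡ 0ℚ
    off j j≢0 j≢1 j≢l = Lmat-far (j≢0 ∘ sym) ¬adj
      where
      ¬adj : ¬ adjModℕ n 0 (toℕ j)
      ¬adj (inj₁ j≡1)                       = j≢1 (toℕ-injective j≡1)
      ¬adj (inj₂ (inj₂ (inj₁ (_ , 1+j≡n)))) = j≢l (toℕ-injective (trans (ℕ.suc-injective 1+j≡n) (sym toℕ-last)))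
      ¬adj (inj₂ (inj₂ (inj₂ (j≡0 , _))))   = j≢0 (toℕ-injective j≡0)

  Lmat-row-last : ∀ (x : Vecℚ n) →
                  (Lmat n ·v x) last ≡ - 1ℚ * x zero + (- 1ℚ * x (inject₁ (fromℕ (suc m))) + ℕtoℚ 2 * x last)
  Lmat-row-last x = begin
    (Lmat n ·v x) last
      ≡⟨ ·v-three-entries (Lmat n) x {i = last} (λ ()) (λ ()) a≢l off ⟩
    Lmat n last zero * x zero + (Lmat n last a * x a + Lmat n last last * x last)
      ≡⟨ cong₂ _+_ (cong (_* x zero) Ll0) (cong₂ _+_ (cong (_* x a) Lla) (cong (_* x last) Lll)) ⟩
    - 1ℚ * x zero + (- 1ℚ * x a + ℕtoℚ 2 * x last)
      ∎
    where
    open ≡-Reasoning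
    a : Fin n
    a = inject₁ (fromℕ (suc m))
    toℕ-a : toℕ a ≡ suc m
    toℕ-a = trans (toℕ-inject₁ (fromℕ (suc m))) (toℕ-fromℕ (suc m))
    l≡1+a : toℕ last ≡ suc (toℕ a)
    l≡1+a = trans toℕ-last (cong suc (sym toℕ-a))
    a≢l : a ≢ last
    a≢l = toℕ-<⇒≢ (ℕ.≤-reflexive (sym l≡1+a))
    Ll0 : Lmat n last zero ≡ - 1ℚ
    Ll0 = Lmat-adjacent (λ ()) (inj₂ (inj₂ (inj₂ (refl , cong suc toℕ-last))))
    Lla : Lmat n last a ≡ - 1ℚ
    Lla = Lmat-adjacent (a≢l ∘ sym) (inj₂ (inj₁ l≡1+a))
    Lll : Lmat n last last ≡ ℕtoℚ 2
    Lll = Lmat-diag toℕ-last toℕ-last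
    off : ∀ j → j ≢ zero → j ≢ a → j ≢ last → Lmat n last j ≡ 0ℚ
    off j j≢0 j≢a j≢l = Lmat-far (j≢l ∘ sym) ¬adj
      where
      ¬adj : ¬ adjModℕ n (toℕ last) (toℕ j)
      ¬adj (inj₁ j≡1+l)                   = ℕ.<⇒≢ (toℕ<n j) (trans j≡1+l (cong suc toℕ-last))
      ¬adj (inj₂ (inj₁ l≡1+j))            = j≢a (toℕ-injective (ℕ.suc-injective (trans (sym l≡1+j) l≡1+a)))
      ¬adj (inj₂ (inj₂ (inj₁ (l≡0 , _)))) = ℕ.0≢1+n (trans (sym l≡0) toℕ-last)
      ¬adj (inj₂ (inj₂ (inj₂ (j≡0 , _)))) = j≢0 (toℕ-injective j≡0)

  Lmat-colSum : ∀ j → colSum (Lmat n) j ≡ identity zero j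
  Lmat-colSum j = trans (colSum-symmetric (Lmat n) Lmat-sym j) (rowSum j)
    where
    rowSum : ∀ j → (Lmat n ·v (λ _ → 1ℚ)) j ≡ identity zero j
    rowSum zero    = Lmat-row-zero (λ _ → 1ℚ)
    rowSum (suc j) with view j
    ... | ‵fromℕ     = Lmat-row-last (λ _ → 1ℚ)
    ... | ‵inject₁ k = Lmat-row-inject₁ (λ _ → 1ℚ) k

proposition5p4 : (m : ℕ) → let n = suc (suc (suc m)) in
    (M : Mat n) → (∀ i j → (Lmat n ⊗ M) i j ≡ identity i j) → (∀ i j → (M ⊗ Lmat n) i j ≡ identity i j) →
    (x : Vecℚ n) → InParallelepiped (scaleMat (ℕtoℚ n) M) x →
    (c : Fin n → ℕ) → (∀ i → c i < n) → (∀ i → x i ≡ (M ·v (λ i → ℕtoℚ (c i))) i) →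
    ((∀ i → IsInt (x i)) ⇔ IsInt (x (suc zero)))
proposition5p4 m M LM≡I _ x _ c _ x≡Mc =
  mk⇔ (λ int-x → int-x (suc zero)) (λ int-x₁ → Fin-twoStepInduction (IsInt ∘ x) int-x₀ int-x₁ step)
  where
  n = suc (suc (suc m))
  v : Vecℚ n
  v i = ℕtoℚ (c i)
  Lx≡v : ∀ i → (Lmat n ·v x) i ≡ v i
  Lx≡v = ·v-leftInverse (Lmat n) M LM≡I x≡Mc
  x₀≡Σv : x zero ≡ sumFin v
  x₀≡Σv = begin
    x zero             ≡⟨ sum-·v-unitColSums (Lmat n) x (Lmat-colSum m) ⟨
    sum (Lmat n ·v x)  ≡⟨ sum-cong-≗ Lx≡v ⟩
    sum v              ≡⟨ sumFin≡sum v ⟨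
    sumFin v           ∎
    where open ≡-Reasoning
  int-x₀ : IsInt (x zero)
  int-x₀ = subst IsInt (sym x₀≡Σv) (isInt-sumFin v (isInt-ℕ ∘ c))
  step : ∀ k → IsInt (x (inject₁ (inject₁ k))) → IsInt (x (suc (inject₁ k))) → IsInt (x (suc (suc k)))
  step k = isInt-secondDifference (trans (sym (Lmat-row-inject₁ x k)) (Lx≡v (suc (inject₁ k))))
                                  (isInt-ℕ (c (suc (inject₁ k))))
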